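{- For every $n\ge 0$, $$\sum_{\sigma\in S_n(3\textrm{ - }1\textrm{ - }2)}x^{occ_{321}(\sigma)}y^{occ_{132}(\sigma)}z^{occ_{213}(\sigma)}=\sum_{\sigma\in S_n(3\textrm{ - }1\textrm{ - }2)}x^{occ_{123}(\sigma)}y^{occ_{231}(\sigma)}z^{occ_{213}(\sigma)}$$ and $$\sum_{\sigma\in S_n(3\textrm{ - }1\textrm{ - }2)}x^{occ_{321}(\sigma)}y^{occ_{231}(\sigma)}z^{occ_{213}(\sigma)}=\sum_{\sigma\in S_n(3\textrm{ - }1\textrm{ - }2)}x^{occ_{123}(\sigma)}y^{occ_{132}(\sigma)}z^{occ_{213}(\sigma)}.$$
   Context: $S_n(3\textrm{ - }1\textrm{ - }2)$ is the set of $\sigma\in S_n$ with no indices $i<j<l$ such that $\sigma(j)<\sigma(l)<\sigma(i)$. For $\tau\in S_3$, $occ_{\tau}(\sigma)$ is the number of indices $i$, $1\le i\le n-2$, such that $\sigma(i)\sigma(i+1)\sigma(i+2)$ is order-isomorphic to $\tau$ (occurrences of the consecutive pattern $\tau$). -}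

module Defs where

open import Level using (Level)
open import Data.Nat using (ℕ; zero; suc; _<ᵇ_)
open import Data.Nat as ℕ using ()
open import Data.Bool using (Bool; true; false; if_then_else_; _∧_)
open import Data.Fin using (Fin; toℕ; _<_; _<?_; _≟_)
open import Data.Fin.Properties using (any?; all?)
open import Data.Vec using (Vec; []; _∷_; lookup; toList)
open import Data.List using (List; []; _∷_; [_]; map; concatMap; filter; foldr; allFin)
open import Data.Product using (∃; ∃-syntax; _×_; _,_)
open import Relation.Nullary using (¬_; Dec; ¬?)
open import Relation.Nullary.Decidable using (_×-dec_; _→-dec_)
open import Relation.Binary.PropositionalEquality using (_≡_)
open import Algebra.Bundles using (CommutativeSemiring)
import Algebra.Definitions.RawSemiring as RS

-- A permutation of [n] is represented by its one-line notation
-- σ = σ(1) … σ(n), a vector of length n over Fin n that is injective.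

Injective : ∀ {n} → Vec (Fin n) n → Set
Injective σ = ∀ i j → lookup σ i ≡ lookup σ j → i ≡ j

injective? : ∀ {n} (σ : Vec (Fin n) n) → Dec (Injective σ)
injective? σ = all? λ i → all? λ j → (lookup σ i ≟ lookup σ j) →-dec (i ≟ j)

Contains312 : ∀ {n} → Vec (Fin n) n → Set
Contains312 σ = ∃[ i ] ∃[ j ] ∃[ l ]
  (i < j × j < l × lookup σ j < lookup σ l × lookup σ l < lookup σ i)

contains312? : ∀ {n} (σ : Vec (Fin n) n) → Dec (Contains312 σ)
contains312? σ = any? λ i → any? λ j → any? λ l →
  (i <? j) ×-dec (j <? l) ×-dec (lookup σ j <? lookup σ l) ×-dec (lookup σ l <? lookup σ i)

IsAv312 : ∀ {n} → Vec (Fin n) n → Set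
IsAv312 σ = Injective σ × ¬ Contains312 σ

isAv312? : ∀ {n} (σ : Vec (Fin n) n) → Dec (IsAv312 σ)
isAv312? σ = injective? σ ×-dec ¬? (contains312? σ)

allVecs : ∀ n k → List (Vec (Fin n) k)
allVecs n zero    = [ [] ]
allVecs n (suc k) = concatMap (λ v → map (_∷ v) (allFin n)) (allVecs n k)

Av312 : ∀ n → List (Vec (Fin n) n)
Av312 n = filter isAv312? (allVecs n n)

record Pat3 : Set where
  constructor pat
  field
    t1 t2 t3 : ℕ

_==ᵇ_ : Bool → Bool → Bool
true  ==ᵇ b = b
false ==ᵇ true = false
false ==ᵇ false = true

orderIso : ℕ → ℕ → ℕ → Pat3 → Bool
orderIso a b c (pat p q r) =
  ((a <ᵇ b) ==ᵇ (p <ᵇ q)) ∧ ((b <ᵇ a) ==ᵇ (q <ᵇ p)) ∧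
  ((a <ᵇ c) ==ᵇ (p <ᵇ r)) ∧ ((c <ᵇ a) ==ᵇ (r <ᵇ p)) ∧
  ((b <ᵇ c) ==ᵇ (q <ᵇ r)) ∧ ((c <ᵇ b) ==ᵇ (r <ᵇ q))

occList : Pat3 → List ℕ → ℕ
occList τ (a ∷ b ∷ c ∷ rest) =
  (if orderIso a b c τ then 1 else 0) ℕ.+ occList τ (b ∷ c ∷ rest)
occList τ _ = 0

occ : ∀ {n} → Pat3 → Vec (Fin n) n → ℕ
occ τ σ = occList τ (map toℕ (toList σ))

p123 p132 p213 p231 p321 : Pat3
p123 = pat 1 2 3
p132 = pat 1 3 2
p213 = pat 2 1 3
p231 = pat 2 3 1
p321 = pat 3 2 1

-- The generating polynomial  Σ_{σ ∈ S_n(3-1-2)} x^{occ_α σ} y^{occ_β σ} z^{occ_γ σ},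
-- evaluated in an arbitrary commutative semiring (an identity for all commutative
-- semirings and all x, y, z is equivalent to an identity in ℕ[x,y,z]).
module _ {c ℓ : Level} (R : CommutativeSemiring c ℓ) where
  open CommutativeSemiring R using (Carrier; _+_; _*_; 0#; rawSemiring)
  open RS rawSemiring using (_^_)

  genPoly : (n : ℕ) (α β γ : Pat3) (x y z : Carrier) → Carrier
  genPoly n α β γ x y z =
    foldr (λ σ acc → (x ^ occ α σ) * (y ^ occ β σ) * (z ^ occ γ σ) + acc) 0# (Av312 n)

-- A 312-avoiding permutation splits at its minimum as u · min · v with every entry of u below every
-- entry of v, so S_n(3-1-2) is in bijection with binary trees on n nodes (root = minimum, subtrees = u
-- and v). The consecutive occurrences of a pattern are those inside u, those inside v, and the at most
-- three windows through the minimum, which only depend on the last step of u and the first step of v.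
-- Mirroring the tree turns windows ending at the minimum into windows starting at it and reverses the
-- adjacent steps; this exchanges 321 with 123 and 132 with 231 and fixes 213, so the induced involution
-- of S_n(3-1-2) carries each generating polynomial onto the other.

module Submission where

open import Defs
open import Level using (Level)
open import Data.Bool using (Bool; true; false; if_then_else_; _∧_)
open import Data.Nat using (ℕ; zero; suc; _+_; _∸_; _≤_; _<_; _<ᵇ_; _<?_; z≤n; s≤s; s≤s⁻¹; z<s)
open import Data.Nat.Properties
open import Data.Fin as Fin using (Fin; toℕ; fromℕ<; punchOut)
open import Data.Fin.Properties
  using (injective⇒≤; toℕ<n; toℕ-fromℕ<; toℕ-injective; any?; punchOut-injective)
open import Data.Vec using (Vec; []; _∷_; lookup; toList)
import Data.Vec.Properties as Vecₚ
open import Data.List using (List; []; _∷_; _++_; length; map; foldr; allFin)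
open import Data.List.Properties using (length-++; ∷-injective; foldr-map; map-∘; map-cong-local)
open import Data.List.Membership.Propositional using (_∈_)
open import Data.List.Membership.Propositional.Properties
  using (∈-map⁺; ∈-map⁻; ∈-allFin; ∈-concat⁺′; ∈-filter⁺; ∈-filter⁻)
open import Data.List.Membership.Propositional.Properties.WithK using (unique∧set⇒bag)
open import Data.List.Relation.Unary.Any using (here)
open import Data.List.Relation.Unary.All as All using (All; []; _∷_)
import Data.List.Relation.Unary.All.Properties as Allₚ
open import Data.List.Relation.Unary.AllPairs as AllPairs using ([]; _∷_)
import Data.List.Relation.Unary.AllPairs.Properties as AllPairsₚ
open import Data.List.Relation.Unary.Unique.Propositional using (Unique)
import Data.List.Relation.Unary.Unique.Propositional.Properties as Uniqueₚ
open import Data.List.Relation.Binary.BagAndSetEquality using (∼bag⇒↭)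
open import Data.List.Relation.Binary.Permutation.Propositional using (_↭_; ↭⇒↭ₛ′)
open import Data.List.Relation.Binary.Permutation.Propositional.Properties using (map⁺)
import Data.List.Relation.Binary.Permutation.Setoid.Properties as PermutationₛProperties
open import Data.Product using (∃; ∃₂; Σ; _×_; _,_; proj₁; proj₂)
open import Data.Empty using (⊥-elim)
open import Function.Bundles using (mk⇔)
open import Relation.Nullary using (¬_; Dec; yes; no)
open import Relation.Binary.Definitions using (tri<; tri≈; tri>)
open import Relation.Binary.PropositionalEquality
  using (_≡_; refl; sym; trans; cong; cong₂; subst; subst₂; module ≡-Reasoning)
open import Algebra.Bundles using (CommutativeMonoid; CommutativeSemiring)
import Algebra.Definitions.RawSemiring as RawSemiringDefs

data Tree : Set where
  leaf : Tree
  node : Tree → Tree → Tree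

size : Tree → ℕ
size leaf       = 0
size (node l r) = suc (size l + size r)

mirror : Tree → Tree
mirror leaf       = leaf
mirror (node l r) = node (mirror r) (mirror l)

mirror-involutive : ∀ t → mirror (mirror t) ≡ t
mirror-involutive leaf       = refl
mirror-involutive (node l r) = cong₂ node (mirror-involutive l) (mirror-involutive r)

size-mirror : ∀ t → size (mirror t) ≡ size t
size-mirror leaf       = refl
size-mirror (node l r) = cong suc (trans (cong₂ _+_ (size-mirror r) (size-mirror l)) (+-comm (size r) (size l)))

word : Tree → ℕ → List ℕ
word leaf       b = []
word (node l r) b = word l (suc b) ++ b ∷ word r (suc b + size l)

length-word : ∀ t b → length (word t b) ≡ size t
length-word leaf       b = refl
length-word (node l r) b = begin
  length (word l (suc b) ++ b ∷ word r (suc b + size l))  ≡⟨ length-++ (word l (suc b)) ⟩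
  length (word l (suc b)) + suc (length (word r _))       ≡⟨ cong₂ (λ p q → p + suc q) (length-word l _) (length-word r _) ⟩
  size l + suc (size r)                                   ≡⟨ +-suc (size l) (size r) ⟩
  suc (size l + size r)                                   ∎
  where open ≡-Reasoning

word-bounded : ∀ t b → All (λ x → b ≤ x × x < b + size t) (word t b)
word-bounded leaf       b = []
word-bounded (node l r) b =
  Allₚ.++⁺ (All.map left (word-bounded l (suc b)))
      ((≤-refl , m<m+n b z<s) ∷ All.map right (word-bounded r (suc b + size l)))
  where
  top : suc b + (size l + size r) ≡ b + size (node l r)
  top = sym (+-suc b _)
  left : ∀ {x} → suc b ≤ x × x < suc b + size l → b ≤ x × x < b + size (node l r)
  left {x} (b<x , x<) = <⇒≤ b<x , subst (x <_) top (<-≤-trans x< (+-monoʳ-≤ (suc b) (m≤m+n (size l) (size r))))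
  right : ∀ {x} → suc b + size l ≤ x × x < suc b + size l + size r → b ≤ x × x < b + size (node l r)
  right {x} (lo≤x , x<) = ≤-trans (m≤m+n b (suc (size l))) (≤-trans (≤-reflexive (+-suc b (size l))) lo≤x)
                    , subst (x <_) (trans (+-assoc (suc b) (size l) (size r)) top) x<

-- u ++ b ∷ v, with b below every entry and every entry of u below every entry of v:
-- the shape of every nonempty tree word, and of every 312-avoiding permutation split at its minimum.
record MinSplit (u : List ℕ) (b : ℕ) (v : List ℕ) : Set where
  field
    min<left   : All (b <_) u
    min<right  : All (b <_) v
    left<right : All (λ x → All (x <_) v) u

word-minSplit : ∀ l r b → MinSplit (word l (suc b)) b (word r (suc b + size l))
word-minSplit l r b = record
  { min<left   = All.map proj₁ (word-bounded l (suc b))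
  ; min<right  = All.map (λ p → <-≤-trans (s≤s (m≤m+n b (size l))) (proj₁ p)) (word-bounded r _)
  ; left<right = All.map (λ p → All.map (λ q → <-≤-trans (proj₂ p) (proj₁ q)) (word-bounded r _))
                         (word-bounded l (suc b))
  }

-- Consecutive patterns

-- flat, the step between equal neighbours, never occurs in a permutation; it only makes step total.
data Step : Set where
  none asc desc flat : Step

step : ℕ → ℕ → Step
step a b = if a <ᵇ b then asc else (if b <ᵇ a then desc else flat)

-- Accumulating, so that lastStep (u ++ x ∷ y ∷ v) reduces to lastStep (x ∷ y ∷ v) by induction on u.
lastStepFrom : Step → ℕ → List ℕ → Step
lastStepFrom s a []      = s
lastStepFrom s a (b ∷ w) = lastStepFrom (step a b) b w

lastStep : List ℕ → Step
lastStep []      = none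
lastStep (a ∷ w) = lastStepFrom none a w

firstStep : List ℕ → Step
firstStep (a ∷ b ∷ _) = step a b
firstStep _           = none

𝟙 : Bool → ℕ
𝟙 b = if b then 1 else 0

-- Whether a window (x, y, m) resp. (m, x, y), with m below x and y and x, y related by s, is an occurrence of τ.
occEndingAtMin : Pat3 → Step → ℕ
occEndingAtMin τ none = 0
occEndingAtMin τ asc  = 𝟙 (orderIso 1 2 0 τ)
occEndingAtMin τ desc = 𝟙 (orderIso 2 1 0 τ)
occEndingAtMin τ flat = 𝟙 (orderIso 1 1 0 τ)

occStartingAtMin : Pat3 → Step → ℕ
occStartingAtMin τ none = 0
occStartingAtMin τ asc  = 𝟙 (orderIso 0 1 2 τ)
occStartingAtMin τ desc = 𝟙 (orderIso 0 2 1 τ)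
occStartingAtMin τ flat = 𝟙 (orderIso 0 1 1 τ)

nonempty : List ℕ → Bool
nonempty []      = false
nonempty (_ ∷ _) = true

occCentredAtMin : Pat3 → (left right : Bool) → ℕ
occCentredAtMin τ left right = if left ∧ right then 𝟙 (orderIso 1 0 2 τ) else 0

<⇒<ᵇ≡true : ∀ {a b} → a < b → (a <ᵇ b) ≡ true
<⇒<ᵇ≡true {zero}  {suc b} _       = refl
<⇒<ᵇ≡true {suc a} {suc b} (s≤s p) = <⇒<ᵇ≡true p

≥⇒<ᵇ≡false : ∀ {a b} → b ≤ a → (a <ᵇ b) ≡ false
≥⇒<ᵇ≡false {a}     {zero}  _       = refl
≥⇒<ᵇ≡false {suc a} {suc b} (s≤s p) = ≥⇒<ᵇ≡false p

step-asc : ∀ {a b} → a < b → step a b ≡ asc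
step-asc a<b rewrite <⇒<ᵇ≡true a<b = refl

step-desc : ∀ {a b} → b < a → step a b ≡ desc
step-desc b<a rewrite ≥⇒<ᵇ≡false (<⇒≤ b<a) | <⇒<ᵇ≡true b<a = refl

orderIso-min-last : ∀ τ {a b c} → c < a → c < b → 𝟙 (orderIso a b c τ) ≡ occEndingAtMin τ (step a b)
orderIso-min-last (pat p q r) {a} {b} c<a c<b with <-cmp a b
... | tri< a<b _ _ rewrite <⇒<ᵇ≡true a<b | ≥⇒<ᵇ≡false (<⇒≤ a<b)
                         | ≥⇒<ᵇ≡false (<⇒≤ c<a) | <⇒<ᵇ≡true c<a | ≥⇒<ᵇ≡false (<⇒≤ c<b) | <⇒<ᵇ≡true c<b = refl
... | tri≈ _ refl _ rewrite ≥⇒<ᵇ≡false (≤-refl {a}) | ≥⇒<ᵇ≡false (<⇒≤ c<a) | <⇒<ᵇ≡true c<a = refl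
... | tri> _ _ b<a rewrite <⇒<ᵇ≡true b<a | ≥⇒<ᵇ≡false (<⇒≤ b<a)
                         | ≥⇒<ᵇ≡false (<⇒≤ c<a) | <⇒<ᵇ≡true c<a | ≥⇒<ᵇ≡false (<⇒≤ c<b) | <⇒<ᵇ≡true c<b = refl

orderIso-min-first : ∀ τ {a b c} → a < b → a < c → 𝟙 (orderIso a b c τ) ≡ occStartingAtMin τ (step b c)
orderIso-min-first (pat p q r) {a} {b} {c} a<b a<c with <-cmp b c
... | tri< b<c _ _ rewrite <⇒<ᵇ≡true b<c | ≥⇒<ᵇ≡false (<⇒≤ b<c)
                         | <⇒<ᵇ≡true a<b | ≥⇒<ᵇ≡false (<⇒≤ a<b) | <⇒<ᵇ≡true a<c | ≥⇒<ᵇ≡false (<⇒≤ a<c) = refl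
... | tri≈ _ refl _ rewrite ≥⇒<ᵇ≡false (≤-refl {b}) | <⇒<ᵇ≡true a<b | ≥⇒<ᵇ≡false (<⇒≤ a<b) = refl
... | tri> _ _ c<b rewrite <⇒<ᵇ≡true c<b | ≥⇒<ᵇ≡false (<⇒≤ c<b)
                         | <⇒<ᵇ≡true a<b | ≥⇒<ᵇ≡false (<⇒≤ a<b) | <⇒<ᵇ≡true a<c | ≥⇒<ᵇ≡false (<⇒≤ a<c) = refl

orderIso-min-middle : ∀ τ {a b c} → b < a → b < c → a < c → orderIso a b c τ ≡ orderIso 1 0 2 τ
orderIso-min-middle (pat p q r) b<a b<c a<c
  rewrite <⇒<ᵇ≡true b<a | ≥⇒<ᵇ≡false (<⇒≤ b<a) | <⇒<ᵇ≡true b<c | ≥⇒<ᵇ≡false (<⇒≤ b<c)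
        | <⇒<ᵇ≡true a<c | ≥⇒<ᵇ≡false (<⇒≤ a<c) = refl

occList-min-∷ : ∀ τ b v → All (b <_) v → occList τ (b ∷ v) ≡ occStartingAtMin τ (firstStep v) + occList τ v
occList-min-∷ τ b []                _                 = refl
occList-min-∷ τ b (v₁ ∷ [])         _                 = refl
occList-min-∷ τ b (v₁ ∷ v₂ ∷ v) (b<v₁ ∷ b<v₂ ∷ _) =
  cong (_+ occList τ (v₁ ∷ v₂ ∷ v)) (orderIso-min-first τ b<v₁ b<v₂)

acrossMin : Pat3 → List ℕ → List ℕ → ℕ
acrossMin τ u v =
  occEndingAtMin τ (lastStep u) + occCentredAtMin τ (nonempty u) (nonempty v) + occStartingAtMin τ (firstStep v)

MinSplit-tail : ∀ {x u b v} → MinSplit (x ∷ u) b v → MinSplit u b v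
MinSplit-tail s = record
  { min<left = All.tail (MinSplit.min<left s) ; min<right = MinSplit.min<right s
  ; left<right = All.tail (MinSplit.left<right s) }

occList-minSplit : ∀ τ {u b v} → MinSplit u b v →
  occList τ (u ++ b ∷ v) ≡ occList τ u + acrossMin τ u v + occList τ v
occList-minSplit τ {[]} {b} {v} s = occList-min-∷ τ b v (MinSplit.min<right s)
occList-minSplit τ {u₁ ∷ []} {b} {[]} s = refl
occList-minSplit τ {u₁ ∷ []} {b} {v₁ ∷ v} s = begin
  𝟙 (orderIso u₁ b v₁ τ) + occList τ (b ∷ v₁ ∷ v)   ≡⟨ cong₂ _+_ (cong 𝟙 (orderIso-min-middle τ b<u₁ b<v₁ u₁<v₁))
                                                                  (occList-min-∷ τ b (v₁ ∷ v) (MinSplit.min<right s)) ⟩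
  𝟙 (orderIso 1 0 2 τ) + (cR + occList τ (v₁ ∷ v))   ≡⟨ sym (+-assoc (𝟙 (orderIso 1 0 2 τ)) cR _) ⟩
  𝟙 (orderIso 1 0 2 τ) + cR + occList τ (v₁ ∷ v)     ∎
  where
  open ≡-Reasoning
  b<u₁ = All.head (MinSplit.min<left s)
  b<v₁ = All.head (MinSplit.min<right s)
  u₁<v₁ = All.head (All.head (MinSplit.left<right s))
  cR = occStartingAtMin τ (firstStep (v₁ ∷ v))
occList-minSplit τ {u₁ ∷ u₂ ∷ []} {b} {v} s = begin
  𝟙 (orderIso u₁ u₂ b τ) + occList τ (u₂ ∷ b ∷ v)   ≡⟨ cong₂ _+_ (orderIso-min-last τ b<u₁ b<u₂)
                                                                  (occList-minSplit τ (MinSplit-tail s)) ⟩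
  cL + (cM + cR + occList τ v)                       ≡⟨ cong (cL +_) (+-assoc cM cR _) ⟩
  cL + (cM + (cR + occList τ v))                     ≡⟨ sym (+-assoc cL cM _) ⟩
  cL + cM + (cR + occList τ v)                       ≡⟨ sym (+-assoc (cL + cM) cR _) ⟩
  cL + cM + cR + occList τ v                         ∎
  where
  open ≡-Reasoning
  b<u₁ = All.head (MinSplit.min<left s)
  b<u₂ = All.head (All.tail (MinSplit.min<left s))
  cL = occEndingAtMin τ (step u₁ u₂)
  cM = occCentredAtMin τ true (nonempty v)
  cR = occStartingAtMin τ (firstStep v)
occList-minSplit τ {u₁ ∷ u₂ ∷ u₃ ∷ u} {b} {v} s = begin
  w + occList τ (u₂ ∷ u₃ ∷ u ++ b ∷ v)              ≡⟨ cong (w +_) (occList-minSplit τ (MinSplit-tail s)) ⟩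
  w + (occList τ (u₂ ∷ u₃ ∷ u) + A + occList τ v)    ≡⟨ sym (+-assoc w _ _) ⟩
  w + (occList τ (u₂ ∷ u₃ ∷ u) + A) + occList τ v    ≡⟨ cong (_+ occList τ v) (sym (+-assoc w _ A)) ⟩
  w + occList τ (u₂ ∷ u₃ ∷ u) + A + occList τ v      ∎
  where
  open ≡-Reasoning
  w = 𝟙 (orderIso u₁ u₂ u₃ τ)
  A = acrossMin τ (u₂ ∷ u₃ ∷ u) v

-- Consecutive patterns read off the tree

isNode : Tree → Bool
isNode leaf       = false
isNode (node _ _) = true

lastStepᵀ : Tree → Step
lastStepᵀ leaf                              = none
lastStepᵀ (node l leaf)                     = if isNode l then desc else none
lastStepᵀ (node _ (node leaf leaf))         = asc
lastStepᵀ (node _ r@(node (node _ _) _))    = lastStepᵀ r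
lastStepᵀ (node _ r@(node leaf (node _ _))) = lastStepᵀ r

firstStepᵀ : Tree → Step
firstStepᵀ leaf                              = none
firstStepᵀ (node leaf r)                     = if isNode r then asc else none
firstStepᵀ (node (node leaf leaf) _)         = desc
firstStepᵀ (node l@(node (node _ _) _) _)    = firstStepᵀ l
firstStepᵀ (node l@(node leaf (node _ _)) _) = firstStepᵀ l

acrossᵀ : Pat3 → Tree → Tree → ℕ
acrossᵀ τ l r =
  occEndingAtMin τ (lastStepᵀ l) + occCentredAtMin τ (isNode l) (isNode r) + occStartingAtMin τ (firstStepᵀ r)

occᵀ : Pat3 → Tree → ℕ
occᵀ τ leaf       = 0
occᵀ τ (node l r) = occᵀ τ l + acrossᵀ τ l r + occᵀ τ r

lastStepFrom-++ : ∀ s a u {x y v} → lastStepFrom s a (u ++ x ∷ y ∷ v) ≡ lastStep (x ∷ y ∷ v)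
lastStepFrom-++ s a []      = refl
lastStepFrom-++ s a (c ∷ u) = lastStepFrom-++ (step a c) c u

lastStep-++-long : ∀ u v → 2 ≤ length v → lastStep (u ++ v) ≡ lastStep v
lastStep-++-long []      v             _ = refl
lastStep-++-long (a ∷ u) (x ∷ y ∷ v) _ = lastStepFrom-++ none a u
lastStep-++-long (a ∷ u) (x ∷ [])     (s≤s ())

lastStepFrom-min-∷ʳ : ∀ s a u {b} → b < a → All (b <_) u → lastStepFrom s a (u ++ b ∷ []) ≡ desc
lastStepFrom-min-∷ʳ s a []      b<a _            = step-desc b<a
lastStepFrom-min-∷ʳ s a (c ∷ u) _   (b<c ∷ b<u) = lastStepFrom-min-∷ʳ (step a c) c u b<c b<u

lastStep-min-∷ʳ : ∀ {u b} → All (b <_) u → 1 ≤ length u → lastStep (u ++ b ∷ []) ≡ desc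
lastStep-min-∷ʳ {a ∷ u} (b<a ∷ b<u) _ = lastStepFrom-min-∷ʳ none a u b<a b<u

firstStep-min-∷ : ∀ {b v} → All (b <_) v → 1 ≤ length v → firstStep (b ∷ v) ≡ asc
firstStep-min-∷ {v = x ∷ v} (b<x ∷ _) _ = step-asc b<x

firstStep-++-long : ∀ u v → 2 ≤ length u → firstStep (u ++ v) ≡ firstStep u
firstStep-++-long (a ∷ c ∷ u) v _       = refl
firstStep-++-long (a ∷ [])     v (s≤s ())

length-word-≥ : ∀ {k} t b → k ≤ size t → k ≤ length (word t b)
length-word-≥ t b k≤ = subst (_ ≤_) (sym (length-word t b)) k≤

lastStep-node-long : ∀ l r b → 2 ≤ size r → lastStep (word (node l r) b) ≡ lastStep (word r (suc b + size l))
lastStep-node-long l r b long = trans (lastStep-++-long (word l (suc b)) (b ∷ w) (s≤s (<⇒≤ long′)))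
                                      (lastStep-++-long (b ∷ []) w long′)
  where
  w = word r (suc b + size l)
  long′ = length-word-≥ r (suc b + size l) long

lastStep-word : ∀ t b → lastStep (word t b) ≡ lastStepᵀ t
lastStep-word leaf                              b = refl
lastStep-word (node leaf leaf)                  b = refl
lastStep-word (node l@(node _ _) leaf)          b =
  lastStep-min-∷ʳ (MinSplit.min<left (word-minSplit l leaf b)) (length-word-≥ l (suc b) (s≤s z≤n))
lastStep-word (node l (node leaf leaf))         b =
  trans (lastStep-++-long (word l (suc b)) _ (s≤s (s≤s z≤n))) (step-asc (s≤s (m≤m+n b (size l))))
lastStep-word (node l r@(node (node _ _) _))    b = trans (lastStep-node-long l r b (s≤s (s≤s z≤n))) (lastStep-word r _)
lastStep-word (node l r@(node leaf (node _ _))) b = trans (lastStep-node-long l r b (s≤s (s≤s z≤n))) (lastStep-word r _)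

firstStep-node-long : ∀ l r b → 2 ≤ size l → firstStep (word (node l r) b) ≡ firstStep (word l (suc b))
firstStep-node-long l r b long = firstStep-++-long (word l (suc b)) _ (length-word-≥ l (suc b) long)

firstStep-word : ∀ t b → firstStep (word t b) ≡ firstStepᵀ t
firstStep-word leaf                              b = refl
firstStep-word (node leaf leaf)                  b = refl
firstStep-word (node leaf r@(node _ _))          b =
  firstStep-min-∷ (MinSplit.min<right (word-minSplit leaf r b)) (length-word-≥ r (suc b + 0) (s≤s z≤n))
firstStep-word (node (node leaf leaf) r)         b = step-desc (n<1+n b)
firstStep-word (node l@(node (node _ _) _) r)    b = trans (firstStep-node-long l r b (s≤s (s≤s z≤n))) (firstStep-word l _)
firstStep-word (node l@(node leaf (node _ _)) r) b = trans (firstStep-node-long l r b (s≤s (s≤s z≤n))) (firstStep-word l _)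

nonempty-++-∷ : ∀ u {b v} → nonempty (u ++ b ∷ v) ≡ true
nonempty-++-∷ []      = refl
nonempty-++-∷ (_ ∷ _) = refl

nonempty-word : ∀ t b → nonempty (word t b) ≡ isNode t
nonempty-word leaf       b = refl
nonempty-word (node l r) b = nonempty-++-∷ (word l (suc b))

occList-word : ∀ τ t b → occList τ (word t b) ≡ occᵀ τ t
occList-word τ leaf       b = refl
occList-word τ (node l r) b = begin
  occList τ (word l (suc b) ++ b ∷ word r c)                       ≡⟨ occList-minSplit τ (word-minSplit l r b) ⟩
  occList τ (word l (suc b)) + acrossMin τ (word l (suc b)) (word r c) + occList τ (word r c)
    ≡⟨ cong₂ _+_ (cong₂ _+_ (occList-word τ l (suc b)) across) (occList-word τ r c) ⟩
  occᵀ τ l + acrossᵀ τ l r + occᵀ τ r                               ∎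
  where
  open ≡-Reasoning
  c = suc b + size l
  across : acrossMin τ (word l (suc b)) (word r c) ≡ acrossᵀ τ l r
  across = cong₂ _+_ (cong₂ _+_ (cong (occEndingAtMin τ) (lastStep-word l (suc b)))
                                (cong₂ (occCentredAtMin τ) (nonempty-word l (suc b)) (nonempty-word r c)))
                     (cong (occStartingAtMin τ) (firstStep-word r c))

-- Mirroring

flip : Step → Step
flip none = none
flip asc  = desc
flip desc = asc
flip flat = flat

isNode-mirror : ∀ t → isNode (mirror t) ≡ isNode t
isNode-mirror leaf       = refl
isNode-mirror (node _ _) = refl

firstStepᵀ-node-long : ∀ l r → 2 ≤ size l → firstStepᵀ (node l r) ≡ firstStepᵀ l
firstStepᵀ-node-long (node (node _ _) _)    r _ = refl
firstStepᵀ-node-long (node leaf (node _ _)) r _ = refl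
firstStepᵀ-node-long (node leaf leaf)       r (s≤s ())

lastStepᵀ-node-long : ∀ l r → 2 ≤ size r → lastStepᵀ (node l r) ≡ lastStepᵀ r
lastStepᵀ-node-long l (node (node _ _) _)    _ = refl
lastStepᵀ-node-long l (node leaf (node _ _)) _ = refl
lastStepᵀ-node-long l (node leaf leaf)       (s≤s ())

size-mirror-≥ : ∀ {k} t → k ≤ size t → k ≤ size (mirror t)
size-mirror-≥ t k≤ = subst (_ ≤_) (sym (size-mirror t)) k≤

firstStepᵀ-mirror : ∀ t → firstStepᵀ (mirror t) ≡ flip (lastStepᵀ t)
lastStepᵀ-mirror  : ∀ t → lastStepᵀ (mirror t) ≡ flip (firstStepᵀ t)

firstStepᵀ-mirror leaf                            = refl
firstStepᵀ-mirror (node leaf leaf)                = refl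
firstStepᵀ-mirror (node (node _ _) leaf)          = refl
firstStepᵀ-mirror (node l (node leaf leaf))       = refl
firstStepᵀ-mirror (node l r@(node (node _ _) _))  =
  trans (firstStepᵀ-node-long (mirror r) (mirror l) (size-mirror-≥ r (s≤s (s≤s z≤n)))) (firstStepᵀ-mirror r)
firstStepᵀ-mirror (node l r@(node leaf (node _ _))) =
  trans (firstStepᵀ-node-long (mirror r) (mirror l) (size-mirror-≥ r (s≤s (s≤s z≤n)))) (firstStepᵀ-mirror r)

lastStepᵀ-mirror leaf                             = refl
lastStepᵀ-mirror (node leaf leaf)                 = refl
lastStepᵀ-mirror (node leaf (node _ _))           = refl
lastStepᵀ-mirror (node (node leaf leaf) r)        = refl
lastStepᵀ-mirror (node l@(node (node _ _) _) r)   =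
  trans (lastStepᵀ-node-long (mirror r) (mirror l) (size-mirror-≥ l (s≤s (s≤s z≤n)))) (lastStepᵀ-mirror l)
lastStepᵀ-mirror (node l@(node leaf (node _ _)) r) =
  trans (lastStepᵀ-node-long (mirror r) (mirror l) (size-mirror-≥ l (s≤s (s≤s z≤n)))) (lastStepᵀ-mirror l)

record MirrorDual (τ τ′ : Pat3) : Set where
  field
    ending   : ∀ s → occEndingAtMin τ′ (flip s) ≡ occStartingAtMin τ s
    starting : ∀ s → occStartingAtMin τ′ (flip s) ≡ occEndingAtMin τ s
    centred  : orderIso 1 0 2 τ′ ≡ orderIso 1 0 2 τ

+-reverse₃ : ∀ a b c → a + b + c ≡ c + b + a
+-reverse₃ a b c = trans (+-comm (a + b) c) (trans (cong (c +_) (+-comm a b)) (sym (+-assoc c b a)))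

module _ {τ τ′ : Pat3} (dual : MirrorDual τ τ′) where
  open MirrorDual dual

  occCentredAtMin-swap : ∀ x y → occCentredAtMin τ′ y x ≡ occCentredAtMin τ x y
  occCentredAtMin-swap false false = refl
  occCentredAtMin-swap false true  = refl
  occCentredAtMin-swap true  false = refl
  occCentredAtMin-swap true  true  = cong 𝟙 centred

  acrossᵀ-mirror : ∀ l r → acrossᵀ τ′ (mirror r) (mirror l) ≡ acrossᵀ τ l r
  acrossᵀ-mirror l r = begin
    acrossᵀ τ′ (mirror r) (mirror l)
      ≡⟨ cong₂ _+_ (cong₂ _+_ (trans (cong (occEndingAtMin τ′) (lastStepᵀ-mirror r)) (ending (firstStepᵀ r)))
                              (trans (cong₂ (occCentredAtMin τ′) (isNode-mirror r) (isNode-mirror l))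
                                     (occCentredAtMin-swap (isNode l) (isNode r))))
                   (trans (cong (occStartingAtMin τ′) (firstStepᵀ-mirror l)) (starting (lastStepᵀ l))) ⟩
    occStartingAtMin τ (firstStepᵀ r) + occCentredAtMin τ (isNode l) (isNode r) + occEndingAtMin τ (lastStepᵀ l)
      ≡⟨ +-reverse₃ (occStartingAtMin τ (firstStepᵀ r)) _ (occEndingAtMin τ (lastStepᵀ l)) ⟩
    acrossᵀ τ l r
      ∎
    where open ≡-Reasoning

  occᵀ-mirror : ∀ t → occᵀ τ′ (mirror t) ≡ occᵀ τ t
  occᵀ-mirror leaf       = refl
  occᵀ-mirror (node l r) =
    trans (cong₂ _+_ (cong₂ _+_ (occᵀ-mirror r) (acrossᵀ-mirror l r)) (occᵀ-mirror l))
          (+-reverse₃ (occᵀ τ r) _ (occᵀ τ l))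

mirrorDual-321-123 : MirrorDual p321 p123
mirrorDual-321-123 = record
  { ending   = λ { none → refl ; asc → refl ; desc → refl ; flat → refl }
  ; starting = λ { none → refl ; asc → refl ; desc → refl ; flat → refl }
  ; centred  = refl }

mirrorDual-132-231 : MirrorDual p132 p231
mirrorDual-132-231 = record
  { ending   = λ { none → refl ; asc → refl ; desc → refl ; flat → refl }
  ; starting = λ { none → refl ; asc → refl ; desc → refl ; flat → refl }
  ; centred  = refl }

mirrorDual-231-132 : MirrorDual p231 p132
mirrorDual-231-132 = record
  { ending   = λ { none → refl ; asc → refl ; desc → refl ; flat → refl }
  ; starting = λ { none → refl ; asc → refl ; desc → refl ; flat → refl }
  ; centred  = refl }

mirrorDual-213-213 : MirrorDual p213 p213
mirrorDual-213-213 = record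
  { ending   = λ { none → refl ; asc → refl ; desc → refl ; flat → refl }
  ; starting = λ { none → refl ; asc → refl ; desc → refl ; flat → refl }
  ; centred  = refl }

-- Tree words are the 312-avoiding arrangements of intervals

-- Entries of a list by position; 0 is a junk value out of range.
nth : List ℕ → ℕ → ℕ
nth []       _       = 0
nth (x ∷ xs) zero    = x
nth (x ∷ xs) (suc i) = nth xs i

Distinct : List ℕ → Set
Distinct w = ∀ {i j} → i < length w → j < length w → nth w i ≡ nth w j → i ≡ j

Has312 : List ℕ → Set
Has312 w = ∃ λ i → ∃ λ j → ∃ λ l →
  i < j × j < l × l < length w × nth w j < nth w l × nth w l < nth w i

Within : List ℕ → ℕ → ℕ → Set
Within w c m = ∀ {i} → i < length w → c ≤ nth w i × nth w i < c + m

Covering : List ℕ → ℕ → ℕ → Set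
Covering w c m = ∀ {y} → c ≤ y → y < c + m → ∃ λ i → i < length w × nth w i ≡ y

record Av312Interval (w : List ℕ) (b : ℕ) : Set where
  field
    distinct  : Distinct w
    avoids312 : ¬ Has312 w
    within    : Within w b (length w)
    covering  : Covering w b (length w)

All-nth : ∀ {P : ℕ → Set} {u i} → All P u → i < length u → P (nth u i)
All-nth {u = x ∷ u} {zero}  (p ∷ _)  _         = p
All-nth {u = x ∷ u} {suc i} (_ ∷ ps) (s≤s i<) = All-nth ps i<

module Positions (u : List ℕ) (b : ℕ) (v : List ℕ) where

  nth-++ˡ : ∀ {i} → i < length u → nth (u ++ b ∷ v) i ≡ nth u i
  nth-++ˡ = go u
    where
    go : ∀ u {i} → i < length u → nth (u ++ b ∷ v) i ≡ nth u i
    go (x ∷ u) {zero}  _         = refl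
    go (x ∷ u) {suc i} (s≤s i<) = go u i<

  nth-++-length : nth (u ++ b ∷ v) (length u) ≡ b
  nth-++-length = go u
    where
    go : ∀ u → nth (u ++ b ∷ v) (length u) ≡ b
    go []      = refl
    go (x ∷ u) = go u

  nth-++ʳ : ∀ k → nth (u ++ b ∷ v) (suc (length u + k)) ≡ nth v k
  nth-++ʳ k = go u
    where
    go : ∀ u → nth (u ++ b ∷ v) (suc (length u + k)) ≡ nth v k
    go []      = refl
    go (x ∷ u) = go u

  length-++-∷ : length (u ++ b ∷ v) ≡ suc (length u + length v)
  length-++-∷ = trans (length-++ u) (+-suc (length u) (length v))

  data Position : ℕ → Set where
    inLeft  : ∀ {i} → i < length u → Position i
    atMin   : Position (length u)
    inRight : ∀ {k} → k < length v → Position (suc (length u + k))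

  position : ∀ i → i < length (u ++ b ∷ v) → Position i
  position i i< with <-cmp i (length u)
  ... | tri< i<u _ _    = inLeft i<u
  ... | tri≈ _ refl _   = atMin
  ... | tri> _ _ u<i    = subst Position eq (inRight (+-cancelˡ-< (suc (length u)) _ _ (subst (_< _) (sym eq) i<′)))
    where
    eq : suc (length u + (i ∸ suc (length u))) ≡ i
    eq = m+[n∸m]≡n u<i
    i<′ : i < suc (length u + length v)
    i<′ = subst (i <_) length-++-∷ i<

  entry : ∀ {i} → Position i → ℕ
  entry (inLeft {i} _)  = nth u i
  entry atMin           = b
  entry (inRight {k} _) = nth v k

  nth-entry : ∀ {i} (p : Position i) → nth (u ++ b ∷ v) i ≡ entry p
  nth-entry (inLeft p)  = nth-++ˡ p
  nth-entry atMin       = nth-++-length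
  nth-entry (inRight _) = nth-++ʳ _

module _ {u b v} (s : MinSplit u b v) where
  open MinSplit s
  open Positions u b v

  private
    b<uᵢ : ∀ {i} → i < length u → b < nth u i
    b<uᵢ = All-nth min<left
    b<vₖ : ∀ {k} → k < length v → b < nth v k
    b<vₖ = All-nth min<right
    uᵢ<vₖ : ∀ {i k} → i < length u → k < length v → nth u i < nth v k
    uᵢ<vₖ i< k< = All-nth (All-nth left<right i<) k<

  distinct-++ : Distinct u → Distinct v → Distinct (u ++ b ∷ v)
  distinct-++ du dv {i} {j} i< j< eq = go pᵢ pⱼ (trans (sym (nth-entry pᵢ)) (trans eq (nth-entry pⱼ)))
    where
    pᵢ = position i i<
    pⱼ = position j j<
    go : ∀ {i j} (p : Position i) (q : Position j) → entry p ≡ entry q → i ≡ j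
    go (inLeft p)  (inLeft q)  e = du p q e
    go (inLeft p)  atMin       e = ⊥-elim (<-irrefl (sym e) (b<uᵢ p))
    go (inLeft p)  (inRight q) e = ⊥-elim (<-irrefl e (uᵢ<vₖ p q))
    go atMin       (inLeft q)  e = ⊥-elim (<-irrefl e (b<uᵢ q))
    go atMin       atMin       e = refl
    go atMin       (inRight q) e = ⊥-elim (<-irrefl e (b<vₖ q))
    go (inRight p) (inLeft q)  e = ⊥-elim (<-irrefl (sym e) (uᵢ<vₖ q p))
    go (inRight p) atMin       e = ⊥-elim (<-irrefl (sym e) (b<vₖ p))
    go (inRight p) (inRight q) e = cong (λ k → suc (length u + k)) (dv p q e)

  private
    min≤nth : ∀ {i} → i < length (u ++ b ∷ v) → b ≤ nth (u ++ b ∷ v) i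
    min≤nth {i} i< = subst (b ≤_) (sym (nth-entry p)) (go p)
      where
      p = position i i<
      go : ∀ {i} (p : Position i) → b ≤ entry p
      go (inLeft q)  = <⇒≤ (b<uᵢ q)
      go atMin       = ≤-refl
      go (inRight q) = <⇒≤ (b<vₖ q)

  avoids312-++ : ¬ Has312 u → ¬ Has312 v → ¬ Has312 (u ++ b ∷ v)
  avoids312-++ nu nv (i , j , l , i<j , j<l , l<w , wⱼ<wₗ , wₗ<wᵢ) with position l l<w
  ... | inLeft l<u =
    nu (i , j , l , i<j , j<l , l<u , subst₂ _<_ (nth-++ˡ j<u) (nth-++ˡ l<u) wⱼ<wₗ
                                    , subst₂ _<_ (nth-++ˡ l<u) (nth-++ˡ (<-trans i<j j<u)) wₗ<wᵢ)
    where j<u = <-trans j<l l<u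
  ... | atMin = <⇒≱ (subst (nth (u ++ b ∷ v) j <_) nth-++-length wⱼ<wₗ) (min≤nth (<-trans j<l l<w))
  ... | inRight {k} k<v with position i (<-trans i<j (<-trans j<l l<w))
  ...   | inLeft i<u = <-asym (subst₂ _<_ (nth-++ʳ k) (nth-++ˡ i<u) wₗ<wᵢ) (uᵢ<vₖ i<u k<v)
  ...   | atMin      = <⇒≱ (subst (nth (u ++ b ∷ v) l <_) nth-++-length wₗ<wᵢ) (min≤nth l<w)
  ...   | inRight {kᵢ} kᵢ<v with position j (<-trans j<l l<w)
  ...     | inLeft j<u  = <-asym i<j (<-trans j<u (s≤s (m≤m+n (length u) kᵢ)))
  ...     | atMin       = <-asym i<j (s≤s (m≤m+n (length u) kᵢ))
  ...     | inRight {kⱼ} _ =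
    nv (kᵢ , kⱼ , k , +-cancelˡ-< (length u) _ _ (s≤s⁻¹ i<j) , +-cancelˡ-< (length u) _ _ (s≤s⁻¹ j<l) , k<v
       , subst₂ _<_ (nth-++ʳ kⱼ) (nth-++ʳ k) wⱼ<wₗ , subst₂ _<_ (nth-++ʳ k) (nth-++ʳ kᵢ) wₗ<wᵢ)


word-distinct : ∀ t b → Distinct (word t b)
word-distinct leaf       b ()
word-distinct (node l r) b = distinct-++ (word-minSplit l r b) (word-distinct l _) (word-distinct r _)

word-avoids312 : ∀ t b → ¬ Has312 (word t b)
word-avoids312 leaf       b (_ , _ , _ , _ , _ , () , _)
word-avoids312 (node l r) b = avoids312-++ (word-minSplit l r b) (word-avoids312 l _) (word-avoids312 r _)

++-∷-injective-min : ∀ {b} xs xs′ {ys ys′} → All (b <_) xs → All (b <_) xs′ →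
  xs ++ b ∷ ys ≡ xs′ ++ b ∷ ys′ → xs ≡ xs′ × ys ≡ ys′
++-∷-injective-min []       []        _          _           refl = refl , refl
++-∷-injective-min []       (x ∷ xs′) _          (b<x ∷ _)   refl = ⊥-elim (<-irrefl refl b<x)
++-∷-injective-min (x ∷ xs) []        (b<x ∷ _)  _           refl = ⊥-elim (<-irrefl refl b<x)
++-∷-injective-min (x ∷ xs) (x′ ∷ xs′) (_ ∷ b<xs) (_ ∷ b<xs′) eq with ∷-injective eq
... | refl , eq′ with ++-∷-injective-min xs xs′ b<xs b<xs′ eq′
... | refl , refl = refl , refl

word-injective : ∀ t t′ b → word t b ≡ word t′ b → t ≡ t′
word-injective leaf       leaf         b eq = refl
word-injective leaf       (node l′ r′) b eq with trans (cong length eq) (length-word (node l′ r′) b)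
... | ()
word-injective (node l r) leaf         b eq with trans (sym (length-word (node l r) b)) (cong length eq)
... | ()
word-injective (node l r) (node l′ r′) b eq
  with ++-∷-injective-min (word l (suc b)) (word l′ (suc b))
         (MinSplit.min<left (word-minSplit l r b)) (MinSplit.min<left (word-minSplit l′ r′ b)) eq
... | eqₗ , eqᵣ with word-injective l l′ (suc b) eqₗ
... | refl = cong (node l) (word-injective r r′ _ eqᵣ)

injection⇒≤ : ∀ {N M} (f : ∀ d → d < N → ℕ) → (∀ d p → f d p < M) →
  (∀ d d′ p p′ → f d p ≡ f d′ p′ → d ≡ d′) → N ≤ M
injection⇒≤ {N} {M} f f<M f-inj = injective⇒≤ {f = g} λ {i} {j} e →
  toℕ-injective (f-inj _ _ _ _ (trans (sym (toℕ-fromℕ< (f<M _ _))) (trans (cong toℕ e) (toℕ-fromℕ< (f<M _ _)))))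
  where
  g : Fin N → Fin M
  g i = fromℕ< (f<M (toℕ i) (toℕ<n i))

distinct-within⇒length≤ : ∀ {w c m} → Distinct w → Within w c m → length w ≤ m
distinct-within⇒length≤ {w} {c} {m} dw ww = injection⇒≤ (λ i _ → nth w i ∸ c) bound inj
  where
  bound : ∀ i (p : i < length w) → nth w i ∸ c < m
  bound i p = subst (nth w i ∸ c <_) (m+n∸m≡n c m) (∸-monoˡ-< (proj₂ (ww p)) (proj₁ (ww p)))
  inj : ∀ i j (p : i < length w) (q : j < length w) → nth w i ∸ c ≡ nth w j ∸ c → i ≡ j
  inj i j p q e = dw p q (∸-cancelʳ-≡ (proj₁ (ww p)) (proj₁ (ww q)) e)

covering⇒≤length : ∀ {w c m} → Covering w c m → m ≤ length w
covering⇒≤length {w} {c} {m} cw = injection⇒≤ (λ d p → proj₁ (hit d p)) (λ d p → proj₁ (proj₂ (hit d p))) inj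
  where
  hit : ∀ d → d < m → ∃ λ i → i < length w × nth w i ≡ c + d
  hit d p = cw (m≤m+n c d) (+-monoʳ-< c p)
  inj : ∀ d d′ p p′ → proj₁ (hit d p) ≡ proj₁ (hit d′ p′) → d ≡ d′
  inj d d′ p p′ e = +-cancelˡ-≡ c d d′
    (trans (sym (proj₂ (proj₂ (hit d p)))) (trans (cong (nth w) e) (proj₂ (proj₂ (hit d′ p′)))))

module SplitAtMin {u b v} (av : Av312Interval (u ++ b ∷ v) b) where
  open Av312Interval av
  open Positions u b v

  private
    w = u ++ b ∷ v
    lu = length u
    lv = length v

    left-index : ∀ {i} → i < lu → i < length w
    left-index p = subst (_ <_) (sym length-++-∷) (<-≤-trans p (m≤n⇒m≤1+n (m≤m+n lu lv)))

    min-index : lu < length w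
    min-index = subst (_ <_) (sym length-++-∷) (s≤s (m≤m+n lu lv))

    right-index : ∀ {k} → k < lv → suc (lu + k) < length w
    right-index p = subst (_ <_) (sym length-++-∷) (s≤s (+-monoʳ-< lu p))

    lu<right-index : ∀ k → lu < suc (lu + k)
    lu<right-index k = s≤s (m≤m+n lu k)

    top : b + length w ≡ suc b + lu + lv
    top = trans (cong (b +_) length-++-∷) (trans (+-suc b _) (cong suc (sym (+-assoc b lu lv))))

    locate : ∀ {y} → b ≤ y → y < b + length w → ∃ λ i → Σ (Position i) λ p → entry p ≡ y
    locate b≤y y< with covering b≤y y<
    ... | i , i< , eq = i , position i i< , trans (sym (nth-entry (position i i<))) eq

  b<uᵢ : ∀ {i} → i < lu → b < nth u i
  b<uᵢ {i} p = ≤∧≢⇒< (subst (b ≤_) (nth-++ˡ p) (proj₁ (within (left-index p)))) λ b≡uᵢ →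
    <-irrefl (distinct (left-index p) min-index (trans (nth-++ˡ p) (trans (sym b≡uᵢ) (sym nth-++-length)))) p

  b<vₖ : ∀ {k} → k < lv → b < nth v k
  b<vₖ {k} p = ≤∧≢⇒< (subst (b ≤_) (nth-++ʳ k) (proj₁ (within (right-index p)))) λ b≡vₖ →
    <-irrefl (distinct min-index (right-index p) (trans nth-++-length (trans b≡vₖ (sym (nth-++ʳ k))))) (lu<right-index k)

  -- otherwise uᵢ, b, vₖ would be an occurrence of 312
  uᵢ<vₖ : ∀ {i k} → i < lu → k < lv → nth u i < nth v k
  uᵢ<vₖ {i} {k} p q with <-cmp (nth u i) (nth v k)
  ... | tri< lt _ _ = lt
  ... | tri≈ _ eq _ = ⊥-elim (<-irrefl (distinct (left-index p) (right-index q)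
                        (trans (nth-++ˡ p) (trans eq (sym (nth-++ʳ k))))) (<-trans p (lu<right-index k)))
  ... | tri> _ _ gt = ⊥-elim (avoids312 (i , lu , suc (lu + k) , p , lu<right-index k , right-index q
                        , subst₂ _<_ (sym nth-++-length) (sym (nth-++ʳ k)) (b<vₖ q)
                        , subst₂ _<_ (sym (nth-++ʳ k)) (sym (nth-++ˡ p)) gt))

  distinctˡ : Distinct u
  distinctˡ p q e = distinct (left-index p) (left-index q) (trans (nth-++ˡ p) (trans e (sym (nth-++ˡ q))))

  distinctʳ : Distinct v
  distinctʳ {k} {k′} p q e = +-cancelˡ-≡ lu k k′ (suc-injective
    (distinct (right-index p) (right-index q) (trans (nth-++ʳ k) (trans e (sym (nth-++ʳ k′))))))

  avoids312ˡ : ¬ Has312 u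
  avoids312ˡ (i , j , l , i<j , j<l , l< , a , c) =
    avoids312 (i , j , l , i<j , j<l , left-index l<
              , subst₂ _<_ (sym (nth-++ˡ (<-trans j<l l<))) (sym (nth-++ˡ l<)) a
              , subst₂ _<_ (sym (nth-++ˡ l<)) (sym (nth-++ˡ (<-trans i<j (<-trans j<l l<)))) c)

  avoids312ʳ : ¬ Has312 v
  avoids312ʳ (i , j , l , i<j , j<l , l< , a , c) =
    avoids312 (suc (lu + i) , suc (lu + j) , suc (lu + l) , s≤s (+-monoʳ-< lu i<j) , s≤s (+-monoʳ-< lu j<l)
              , right-index l<
              , subst₂ _<_ (sym (nth-++ʳ j)) (sym (nth-++ʳ l)) a , subst₂ _<_ (sym (nth-++ʳ l)) (sym (nth-++ʳ i)) c)

  -- A too large uᵢ would leave all of b + 1, …, b + 1 + |u| (|u| + 1 values) to be found in u.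
  uᵢ<top : ∀ {i} → i < lu → nth u i < suc b + lu
  uᵢ<top {i} p with nth u i <? suc b + lu
  ... | yes lt = lt
  ... | no ¬lt = ⊥-elim (<-irrefl refl (covering⇒≤length {u} found))
    where
    y≤uᵢ : ∀ {y} → y < suc b + suc lu → y ≤ nth u i
    y≤uᵢ {y} y< = ≤-trans (s≤s⁻¹ (subst (y <_) (+-suc (suc b) lu) y<)) (≮⇒≥ ¬lt)
    uᵢ<end : nth u i < b + length w
    uᵢ<end = subst (_< b + length w) (nth-++ˡ p) (proj₂ (within (left-index p)))
    found : Covering u (suc b) (suc lu)
    found b<y y< with locate (<⇒≤ b<y) (≤-<-trans (y≤uᵢ y<) uᵢ<end)
    ... | _ , inLeft q  , e = _ , q , e
    ... | _ , atMin     , e = ⊥-elim (<-irrefl e b<y)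
    ... | _ , inRight q , e = ⊥-elim (<⇒≱ (uᵢ<vₖ p q) (subst (_≤ nth u i) (sym e) (y≤uᵢ y<)))

  private
    left-end≤end : suc b + lu ≤ b + length w
    left-end≤end = subst (suc b + lu ≤_) (sym top) (m≤m+n (suc b + lu) lv)

  -- Were y an entry of v, all of u would lie among the fewer than |u| values b + 1, …, y − 1.
  coveringˡ : Covering u (suc b) lu
  coveringˡ {y} b<y y< with locate (<⇒≤ b<y) (<-≤-trans y< left-end≤end)
  ... | _ , inLeft q        , e = _ , q , e
  ... | _ , atMin           , e = ⊥-elim (<-irrefl e b<y)
  ... | _ , inRight {k} k<  , e = ⊥-elim (<⇒≱ y∸<lu (distinct-within⇒length≤ {u} distinctˡ below-y))
    where
    y∸<lu : y ∸ suc b < lu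
    y∸<lu = subst (y ∸ suc b <_) (m+n∸m≡n (suc b) lu) (∸-monoˡ-< y< b<y)
    below-y : Within u (suc b) (y ∸ suc b)
    below-y p = b<uᵢ p , subst (_ <_) (trans e (sym (m+[n∸m]≡n b<y))) (uᵢ<vₖ p k<)

  withinˡ : Within u (suc b) lu
  withinˡ p = b<uᵢ p , uᵢ<top p

  withinʳ : Within v (suc b + lu) lv
  withinʳ {k} p = bottom , subst₂ _<_ (nth-++ʳ k) top (proj₂ (within (right-index p)))
    where
    bottom : suc b + lu ≤ nth v k
    bottom with nth v k <? suc b + lu
    ... | no ¬lt = ≮⇒≥ ¬lt
    ... | yes lt with coveringˡ (b<vₖ p) lt
    ... | i , i< , e = ⊥-elim (<-asym i< (subst (lu <_)
            (sym (distinct (left-index i<) (right-index p) (trans (nth-++ˡ i<) (trans e (sym (nth-++ʳ k))))))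
            (lu<right-index k)))

  coveringʳ : Covering v (suc b + lu) lv
  coveringʳ {y} top≤y y< with locate (≤-trans (≤-trans (n≤1+n b) (m≤m+n (suc b) lu)) top≤y) (subst (y <_) (sym top) y<)
  ... | _ , inLeft q  , e = ⊥-elim (<⇒≱ (uᵢ<top q) (subst (_ ≤_) (sym e) top≤y))
  ... | _ , atMin     , e = ⊥-elim (<⇒≱ (<-≤-trans (s≤s (m≤m+n b lu)) top≤y) (≤-reflexive (sym e)))
  ... | _ , inRight q , e = _ , q , e

  left : Av312Interval u (suc b)
  left = record { distinct = distinctˡ ; avoids312 = avoids312ˡ ; within = withinˡ ; covering = coveringˡ }

  right : Av312Interval v (suc b + lu)
  right = record { distinct = distinctʳ ; avoids312 = avoids312ʳ ; within = withinʳ ; covering = coveringʳ }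

split-at : ∀ w {k y} → k < length w → nth w k ≡ y → ∃₂ λ u v → w ≡ u ++ y ∷ v
split-at (x ∷ w) {zero}  _         refl = [] , w , refl
split-at (x ∷ w) {suc k} (s≤s k<) eq with split-at w k< eq
... | u , v , refl = x ∷ u , v , refl

-- The fuel bounds the length of the word, so that the recursion on both halves is structural.
tree-of    : ∀ fuel w b → length w ≤ fuel → Av312Interval w b → ∃ λ t → word t b ≡ w
tree-of-++ : ∀ fuel {u b v} → length u + length v ≤ fuel → Av312Interval (u ++ b ∷ v) b →
             ∃ λ t → word t b ≡ u ++ b ∷ v

tree-of fuel       []       b _    _  = leaf , refl
tree-of zero       (_ ∷ _)  b ()   _
tree-of (suc fuel) w@(_ ∷ _) b len≤ av with Av312Interval.covering av ≤-refl (m<m+n b z<s)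
... | k , k< , wₖ≡b with split-at w k< wₖ≡b
... | u , v , eq =
  subst (λ w′ → ∃ λ t → word t b ≡ w′) (sym eq) (tree-of-++ fuel len≤′ (subst (λ w′ → Av312Interval w′ b) eq av))
  where
  len≤′ : length u + length v ≤ fuel
  len≤′ = s≤s⁻¹ (subst (_≤ suc fuel) (trans (cong length eq) (Positions.length-++-∷ u b v)) len≤)

tree-of-++ fuel {u} {b} {v} len≤ av
  with tree-of fuel u (suc b) (≤-trans (m≤m+n _ _) len≤) (SplitAtMin.left av)
     | tree-of fuel v (suc b + length u) (≤-trans (m≤n+m _ _) len≤) (SplitAtMin.right av)
... | l , refl | r , refl =
  node l r , cong (λ n → word l (suc b) ++ b ∷ word r (suc b + n)) (sym (length-word l (suc b)))

-- Permutations as vectors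

entries : ∀ {m k} → Vec (Fin m) k → List ℕ
entries σ = map toℕ (toList σ)

length-entries : ∀ {m k} (σ : Vec (Fin m) k) → length (entries σ) ≡ k
length-entries []      = refl
length-entries (x ∷ σ) = cong suc (length-entries σ)

toℕ-lookup : ∀ {m k} (σ : Vec (Fin m) k) i → toℕ (lookup σ i) ≡ nth (entries σ) (toℕ i)
toℕ-lookup (x ∷ σ) Fin.zero    = refl
toℕ-lookup (x ∷ σ) (Fin.suc i) = toℕ-lookup σ i

entries-injective : ∀ {m k} (σ σ′ : Vec (Fin m) k) → entries σ ≡ entries σ′ → σ ≡ σ′
entries-injective []      []        _  = refl
entries-injective (x ∷ σ) (x′ ∷ σ′) eq with ∷-injective eq
... | x≡x′ , σ≡σ′ = cong₂ _∷_ (toℕ-injective x≡x′) (entries-injective σ σ′ σ≡σ′)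

injective⇒surjective : ∀ {n} (σ : Vec (Fin n) n) → Injective σ → ∀ y → ∃ λ i → lookup σ i ≡ y
injective⇒surjective {suc m} σ inj y with any? (λ i → lookup σ i Fin.≟ y)
... | yes hit  = hit
... | no  miss = ⊥-elim (1+n≰n (injective⇒≤ {f = λ i → punchOut (y≢σ i)}
                                              (λ eq → inj _ _ (punchOut-injective (y≢σ _) (y≢σ _) eq))))
  where
  y≢σ : ∀ i → ¬ y ≡ lookup σ i
  y≢σ i e = miss (i , sym e)

module _ {n} (σ : Vec (Fin n) n) where

  private
    position : ∀ {i} → i < length (entries σ) → Fin n
    position {i} p = fromℕ< (subst (i <_) (length-entries σ) p)

    toℕ-position : ∀ {i} (p : i < length (entries σ)) → toℕ (position p) ≡ i
    toℕ-position p = toℕ-fromℕ< _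

    nth-position : ∀ {i} (p : i < length (entries σ)) → nth (entries σ) i ≡ toℕ (lookup σ (position p))
    nth-position {i} p = trans (cong (nth (entries σ)) (sym (toℕ-position p))) (sym (toℕ-lookup σ (position p)))

    toℕ<length : ∀ (i : Fin n) → toℕ i < length (entries σ)
    toℕ<length i = subst (toℕ i <_) (sym (length-entries σ)) (toℕ<n i)

  injective⇒distinct : Injective σ → Distinct (entries σ)
  injective⇒distinct inj {i} {j} p q eq =
    trans (sym (toℕ-position p)) (trans (cong toℕ (inj _ _ (toℕ-injective
      (trans (sym (nth-position p)) (trans eq (nth-position q)))))) (toℕ-position q))

  distinct⇒injective : Distinct (entries σ) → Injective σ
  distinct⇒injective d i j eq = toℕ-injective (d (toℕ<length i) (toℕ<length j)
    (trans (sym (toℕ-lookup σ i)) (trans (cong toℕ eq) (toℕ-lookup σ j))))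

  has312⇒contains312 : Has312 (entries σ) → Contains312 σ
  has312⇒contains312 (i , j , l , i<j , j<l , l< , a , c) =
    position i< , position j< , position l<
    , subst₂ _<_ (sym (toℕ-position i<)) (sym (toℕ-position j<)) i<j
    , subst₂ _<_ (sym (toℕ-position j<)) (sym (toℕ-position l<)) j<l
    , subst₂ _<_ (nth-position j<) (nth-position l<) a
    , subst₂ _<_ (nth-position l<) (nth-position i<) c
    where
    j< = <-trans j<l l<
    i< = <-trans i<j j<

  contains312⇒has312 : Contains312 σ → Has312 (entries σ)
  contains312⇒has312 (i , j , l , i<j , j<l , a , c) =
    toℕ i , toℕ j , toℕ l , i<j , j<l , toℕ<length l
    , subst₂ _<_ (toℕ-lookup σ j) (toℕ-lookup σ l) a , subst₂ _<_ (toℕ-lookup σ l) (toℕ-lookup σ i) c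

  av312Interval : IsAv312 σ → Av312Interval (entries σ) 0
  av312Interval (inj , ¬c) = record
    { distinct  = injective⇒distinct inj
    ; avoids312 = λ h → ¬c (has312⇒contains312 h)
    ; within    = λ p → z≤n , subst₂ _<_ (sym (nth-position p)) (sym (length-entries σ)) (toℕ<n _)
    ; covering  = covering
    }
    where
    covering : Covering (entries σ) 0 (length (entries σ))
    covering {y} _ y< with injective⇒surjective σ inj (fromℕ< (subst (y <_) (length-entries σ) y<))
    ... | i , eq = toℕ i , toℕ<length i , trans (sym (toℕ-lookup σ i)) (trans (cong toℕ eq) (toℕ-fromℕ< _))

  treeOf : IsAv312 σ → ∃ λ t → word t 0 ≡ entries σ
  treeOf av = tree-of (length (entries σ)) (entries σ) 0 ≤-refl (av312Interval av)

vecOf : ∀ {n} k (w : List ℕ) → length w ≡ k → All (_< n) w → Vec (Fin n) k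
vecOf zero    []      _  []       = []
vecOf (suc k) (x ∷ w) eq (x< ∷ ps) = fromℕ< x< ∷ vecOf k w (suc-injective eq) ps

entries-vecOf : ∀ {n} k w (eq : length w ≡ k) (ps : All (_< n) w) → entries (vecOf k w eq ps) ≡ w
entries-vecOf zero    []      _  []        = refl
entries-vecOf (suc k) (x ∷ w) eq (x< ∷ ps) = cong₂ _∷_ (toℕ-fromℕ< x<) (entries-vecOf k w (suc-injective eq) ps)

permOf : ∀ {n} t → size t ≡ n → Vec (Fin n) n
permOf {n} t eq = vecOf n (word t 0) (trans (length-word t 0) eq)
                          (All.map (λ p → subst (_ <_) eq (proj₂ p)) (word-bounded t 0))

entries-permOf : ∀ {n} t (eq : size t ≡ n) → entries (permOf t eq) ≡ word t 0
entries-permOf {n} t eq = entries-vecOf n (word t 0) _ _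

permOf-av312 : ∀ {n} t (eq : size t ≡ n) → IsAv312 (permOf t eq)
permOf-av312 t eq =
  distinct⇒injective (permOf t eq) (subst Distinct (sym (entries-permOf t eq)) (word-distinct t 0)) ,
  λ c → word-avoids312 t 0 (subst Has312 (entries-permOf t eq) (contains312⇒has312 (permOf t eq) c))

size-of-word : ∀ {n} (σ : Vec (Fin n) n) t → word t 0 ≡ entries σ → size t ≡ n
size-of-word σ t eq = trans (sym (length-word t 0)) (trans (cong length eq) (length-entries σ))

-- The involution of S_n(3-1-2) induced by mirroring trees, extended by the identity to all other vectors.
mirror312 : ∀ {n} → Vec (Fin n) n → Vec (Fin n) n
mirror312 σ with isAv312? σ
... | no  _  = σ
... | yes av with treeOf σ av
... | t , eq = permOf (mirror t) (trans (size-mirror t) (size-of-word σ t eq))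

module _ {n} {σ : Vec (Fin n) n} (av : IsAv312 σ) where

  entries-mirror312 : ∀ t → word t 0 ≡ entries σ → entries (mirror312 σ) ≡ word (mirror t) 0
  entries-mirror312 t eq with isAv312? σ
  ... | no ¬av = ⊥-elim (¬av av)
  ... | yes av′ with treeOf σ av′
  ... | t′ , eq′ with word-injective t′ t 0 (trans eq′ (sym eq))
  ... | refl = entries-permOf (mirror t) _

  mirror312-av312 : IsAv312 (mirror312 σ)
  mirror312-av312 with isAv312? σ
  ... | no ¬av = ⊥-elim (¬av av)
  ... | yes av′ with treeOf σ av′
  ... | t , _ = permOf-av312 (mirror t) _

  occ-mirror312 : ∀ {τ τ′} → MirrorDual τ τ′ → occ τ′ (mirror312 σ) ≡ occ τ σ
  occ-mirror312 {τ} {τ′} dual with treeOf σ av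
  ... | t , eq = begin
    occList τ′ (entries (mirror312 σ))  ≡⟨ cong (occList τ′) (entries-mirror312 t eq) ⟩
    occList τ′ (word (mirror t) 0)      ≡⟨ occList-word τ′ (mirror t) 0 ⟩
    occᵀ τ′ (mirror t)                  ≡⟨ occᵀ-mirror dual t ⟩
    occᵀ τ t                            ≡⟨ sym (occList-word τ t 0) ⟩
    occList τ (word t 0)                ≡⟨ cong (occList τ) eq ⟩
    occList τ (entries σ)               ∎
    where open ≡-Reasoning

mirror312-fixes : ∀ {n} {σ : Vec (Fin n) n} → ¬ IsAv312 σ → mirror312 σ ≡ σ
mirror312-fixes {σ = σ} ¬av with isAv312? σ
... | no  _  = refl
... | yes av = ⊥-elim (¬av av)

mirror312-involutive : ∀ {n} (σ : Vec (Fin n) n) → mirror312 (mirror312 σ) ≡ σ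
mirror312-involutive σ = involutive (isAv312? σ)
  where
  involutive : Dec (IsAv312 σ) → mirror312 (mirror312 σ) ≡ σ
  involutive (no ¬av) = trans (cong mirror312 (mirror312-fixes ¬av)) (mirror312-fixes ¬av)
  involutive (yes av) with treeOf σ av
  ... | t , eq = entries-injective _ _ (begin
    entries (mirror312 (mirror312 σ))  ≡⟨ entries-mirror312 (mirror312-av312 av) (mirror t) (sym (entries-mirror312 av t eq)) ⟩
    word (mirror (mirror t)) 0          ≡⟨ cong (λ t → word t 0) (mirror-involutive t) ⟩
    word t 0                            ≡⟨ eq ⟩
    entries σ                           ∎)
    where open ≡-Reasoning

∈-allVecs : ∀ {n k} (v : Vec (Fin n) k) → v ∈ allVecs n k
∈-allVecs []      = here refl
∈-allVecs {n} (x ∷ v) = ∈-concat⁺′ (∈-map⁺ (_∷ v) (∈-allFin x)) (∈-map⁺ (λ w → map (_∷ w) (allFin n)) (∈-allVecs v))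

allVecs-unique : ∀ n k → Unique (allVecs n k)
allVecs-unique n zero    = [] ∷ []
allVecs-unique n (suc k) = Uniqueₚ.concat⁺
  (Allₚ.map⁺ (All.tabulate λ _ → Uniqueₚ.map⁺ Vecₚ.∷-injectiveˡ (Uniqueₚ.allFin⁺ n)))
  (AllPairsₚ.map⁺ (AllPairs.map disjoint (allVecs-unique n k)))
  where
  disjoint : ∀ {v w : Vec (Fin n) k} → ¬ v ≡ w → ∀ {u} → ¬ (u ∈ map (_∷ v) (allFin n) × u ∈ map (_∷ w) (allFin n))
  disjoint v≢w (p , q) with ∈-map⁻ (_∷ _) p | ∈-map⁻ (_∷ _) q
  ... | _ , _ , refl | _ , _ , eq = v≢w (Vecₚ.∷-injectiveʳ eq)

∈-Av312⁻ : ∀ {n} {σ : Vec (Fin n) n} → σ ∈ Av312 n → IsAv312 σ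
∈-Av312⁻ {n} p = proj₂ (∈-filter⁻ isAv312? {xs = allVecs n n} p)

∈-Av312⁺ : ∀ {n} {σ : Vec (Fin n) n} → IsAv312 σ → σ ∈ Av312 n
∈-Av312⁺ {n} {σ} av = ∈-filter⁺ isAv312? {xs = allVecs n n} (∈-allVecs σ) av

mirror312-preserves-Av312 : ∀ {n} {σ : Vec (Fin n) n} → σ ∈ Av312 n → mirror312 σ ∈ Av312 n
mirror312-preserves-Av312 p = ∈-Av312⁺ (mirror312-av312 (∈-Av312⁻ p))

map-mirror312-Av312 : ∀ n → map mirror312 (Av312 n) ↭ Av312 n
map-mirror312-Av312 n = ∼bag⇒↭ (unique∧set⇒bag (Uniqueₚ.map⁺ injective unique) unique (mk⇔ to from))
  where
  unique = Uniqueₚ.filter⁺ isAv312? (allVecs-unique n n)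
  injective : ∀ {σ σ′ : Vec (Fin n) n} → mirror312 σ ≡ mirror312 σ′ → σ ≡ σ′
  injective {σ} {σ′} eq = trans (sym (mirror312-involutive σ)) (trans (cong mirror312 eq) (mirror312-involutive σ′))
  to : ∀ {σ} → σ ∈ map mirror312 (Av312 n) → σ ∈ Av312 n
  to p with ∈-map⁻ mirror312 p
  ... | _ , q , refl = mirror312-preserves-Av312 q
  from : ∀ {σ} → σ ∈ Av312 n → σ ∈ map mirror312 (Av312 n)
  from {σ} p = subst (_∈ map mirror312 (Av312 n)) (mirror312-involutive σ) (∈-map⁺ mirror312 (mirror312-preserves-Av312 p))

module _ {c ℓ : Level} (M : CommutativeMonoid c ℓ) where
  open CommutativeMonoid M using (Carrier; _≈_; _∙_; ε; setoid; isEquivalence; isCommutativeMonoid)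
  open PermutationₛProperties setoid using (foldr-commMonoid)
  open import Relation.Binary.Reasoning.Setoid setoid

  sum-reindex : ∀ {A : Set} (F G : A → Carrier) (h : A → A) xs → map h xs ↭ xs → All (λ a → F a ≡ G (h a)) xs →
    foldr (λ a s → F a ∙ s) ε xs ≈ foldr (λ a s → G a ∙ s) ε xs
  sum-reindex F G h xs perm F≡G∘h = begin
    foldr (λ a s → F a ∙ s) ε xs       ≡⟨ foldr-map _∙_ F ε xs ⟨
    foldr _∙_ ε (map F xs)             ≡⟨ cong (foldr _∙_ ε) (trans (map-cong-local F≡G∘h) (map-∘ xs)) ⟩
    foldr _∙_ ε (map G (map h xs))     ≈⟨ foldr-commMonoid isCommutativeMonoid (↭⇒↭ₛ′ isEquivalence (map⁺ G perm)) ⟩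
    foldr _∙_ ε (map G xs)             ≡⟨ foldr-map _∙_ G ε xs ⟩
    foldr (λ a s → G a ∙ s) ε xs       ∎

module _ {c ℓ : Level} (R : CommutativeSemiring c ℓ) where
  open CommutativeSemiring R using (Carrier; _≈_; _*_; rawSemiring; +-commutativeMonoid)
  open RawSemiringDefs rawSemiring using (_^_)

  genPoly-mirror : ∀ n {α β γ α′ β′ γ′} → MirrorDual α α′ → MirrorDual β β′ → MirrorDual γ γ′ →
    ∀ x y z → genPoly R n α β γ x y z ≈ genPoly R n α′ β′ γ′ x y z
  genPoly-mirror n {α} {β} {γ} {α′} {β′} {γ′} dα dβ dγ x y z =
    sum-reindex +-commutativeMonoid (monomial α β γ) (monomial α′ β′ γ′) mirror312 (Av312 n) (map-mirror312-Av312 n)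
                (All.tabulate λ p → sym (monomial-mirror312 (∈-Av312⁻ p)))
    where
    monomial : Pat3 → Pat3 → Pat3 → Vec (Fin n) n → Carrier
    monomial a b c σ = (x ^ occ a σ) * (y ^ occ b σ) * (z ^ occ c σ)
    monomial-mirror312 : ∀ {σ} → IsAv312 σ → monomial α′ β′ γ′ (mirror312 σ) ≡ monomial α β γ σ
    monomial-mirror312 av = cong₂ _*_ (cong₂ _*_ (cong (x ^_) (occ-mirror312 av dα)) (cong (y ^_) (occ-mirror312 av dβ)))
                                      (cong (z ^_) (occ-mirror312 av dγ))

theorem15 : {c ℓ : Level} (R : CommutativeSemiring c ℓ) (n : ℕ)
    (x y z : CommutativeSemiring.Carrier R) →
    CommutativeSemiring._≈_ R (genPoly R n p321 p132 p213 x y z) (genPoly R n p123 p231 p213 x y z)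
    × CommutativeSemiring._≈_ R (genPoly R n p321 p231 p213 x y z) (genPoly R n p123 p132 p213 x y z)
theorem15 R n x y z =
    genPoly-mirror R n mirrorDual-321-123 mirrorDual-132-231 mirrorDual-213-213 x y z
  , genPoly-mirror R n mirrorDual-321-123 mirrorDual-231-132 mirrorDual-213-213 x y z
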